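{- Let $T$ be a tournament and $X=(v_1,\dots,v_k)$, $k\ge2$, a list of distinct vertices of $T$ such that $d^-(v_1)=1$ and, for each $i\in\{2,\dots,k\}$, $(v_i,v_{i-1})\in A(T)$ and $d^-(v_i)=i-1$ (in-degrees taken in $T$). Then $T[\{v_1,\dots,v_k\}]$ is the tournament $U_k$, i.e. the map sending $v_i$ to the $i$-th vertex of $U_k$ is an isomorphism.
   Context: A tournament is a digraph with exactly one arc between each pair of distinct vertices; $d^-$ denotes in-degree. $U_k$ is the tournament with vertex set $\{u_1,\dots,u_k\}$ and arcs $(u_{i+1},u_i)$ for $1\le i\le k-1$ and $(u_i,u_j)$ for $1\le i<k$, $i+1<j\le k$. -}

module Defs where

open import Data.Nat using (ℕ; suc; _<_)
open import Data.Bool using (Bool; true; false; not; _∨_)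
open import Data.Fin using (Fin; toℕ)
open import Data.List using (length; filterᵇ; allFin)
open import Data.Nat using (_≡ᵇ_; _<ᵇ_)
open import Relation.Binary.PropositionalEquality using (_≡_; _≢_)

record Tournament (n : ℕ) : Set where
  field
    arc       : Fin n → Fin n → Bool
    loopless  : ∀ v → arc v v ≡ false
    oneArc    : ∀ u v → u ≢ v → arc u v ≡ not (arc v u)

open Tournament public

indeg : ∀ {n} → Tournament n → Fin n → ℕ
indeg {n} T v = length (filterᵇ (λ u → arc T u v) (allFin n))

-- Arcs of U_k, with vertices 0-indexed (vertex i ↔ u_{i+1}):
-- (u_{i+1}, u_i) for consecutive vertices, and (u_i, u_j) whenever i + 1 < j.
UArc : (k : ℕ) → Fin k → Fin k → Bool
UArc k i j = (toℕ i ≡ᵇ suc (toℕ j)) ∨ (suc (toℕ i) <ᵇ toℕ j)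

{-# OPTIONS --safe #-}
module Submission where

-- If some arc went backwards, vⱼ → vᵢ with i + 1 < j, then vᵢ would receive
-- arcs from vⱼ, from vᵢ₊₁, and (by strong induction on i) from every vₘ with m + 1 < i:
-- that is 2 + (i ∸ 1) distinct in-neighbours, one too many.  So every arc vᵢ → vⱼ with
-- i + 1 < j is present, the arcs vᵢ₊₁ → vᵢ are given, and the tournament property
-- decides the remaining pairs.

open import Defs
open import Data.Nat using (ℕ; zero; suc; _≤_; _<_; _∸_; s<s)
open import Data.Nat.Properties
  using (<-cmp; ≤-trans; ≤-reflexive; <-trans; n<1+n; <⇒≤; <⇒≢; >⇒≢; n≮n; m∸n≤m; m≤n⇒m<n∨m≡n; ≡ᵇ⇒≡; ≡⇒≡ᵇ; <ᵇ⇒<; <⇒<ᵇ)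
open import Data.Bool using (true; false; not; T?)
open import Data.Bool.Properties using (T-≡; T-∨; ⇔→≡; not-¬)
open import Data.Fin using (Fin; toℕ; fromℕ<; inject≤; _≟_) renaming (_<_ to _<ᶠ_)
open import Data.Fin.Properties using (toℕ<n; toℕ-injective; toℕ-fromℕ<; toℕ-inject≤; inject≤-injective; injective⇒≤)
open import Data.Fin.Induction using (<-wellFounded)
open import Data.List using (List; length)
open import Data.List.Membership.Propositional using (_∈_)
open import Data.List.Membership.Propositional.Properties using (∈-filter⁺; ∈-allFin)
open import Data.List.Membership.Setoid.Properties using (index-injective)
open import Data.Product using (_×_; proj₁; proj₂)
open import Data.Sum using (_⊎_; inj₁; inj₂; map)
open import Data.Vec.Functional using (_∷_)
open import Function using (_∘_; mk⇔; Equivalence)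
open import Function.Definitions using (Injective)
open import Induction.WellFounded using (Acc; acc)
open import Relation.Binary using (tri<; tri≈; tri>)
open import Relation.Binary.PropositionalEquality using (_≡_; _≢_; refl; sym; trans; cong; subst; setoid)
open import Relation.Nullary using (contradiction; yes; no)

injective-∷ : ∀ {A : Set} {m} {x : A} {f : Fin m → A}
            → Injective _≡_ _≡_ f → (∀ a → x ≢ f a) → Injective _≡_ _≡_ (x ∷ f)
injective-∷ f-inj x∉f {Fin.zero}  {Fin.zero}  _  = refl
injective-∷ f-inj x∉f {Fin.zero}  {Fin.suc b} eq = contradiction eq (x∉f b)
injective-∷ f-inj x∉f {Fin.suc a} {Fin.zero}  eq = contradiction (sym eq) (x∉f a)
injective-∷ f-inj x∉f {Fin.suc a} {Fin.suc b} eq = cong Fin.suc (f-inj eq)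

injective⇒≤length : ∀ {A : Set} {m} (xs : List A) (f : Fin m → A)
                  → Injective _≡_ _≡_ f → (∀ a → f a ∈ xs) → m ≤ length xs
injective⇒≤length xs f f-inj f∈xs =
  injective⇒≤ (λ {a} {b} eq → f-inj (index-injective (setoid _) (f∈xs a) (f∈xs b) eq))

m<n∸1⇒1+m<n : ∀ {m} n → m < n ∸ 1 → suc m < n
m<n∸1⇒1+m<n (suc n) m<n = s<s m<n

UArcRel : ℕ → ℕ → Set
UArcRel a b = a ≡ suc b ⊎ suc a < b

UArcRel-connex : ∀ {a b} → a ≢ b → UArcRel a b ⊎ UArcRel b a
UArcRel-connex {a} {b} a≢b with <-cmp a b
... | tri≈ _ a≡b _ = contradiction a≡b a≢b
... | tri< a<b _ _ with m≤n⇒m<n∨m≡n a<b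
...   | inj₁ 1+a<b = inj₁ (inj₂ 1+a<b)
...   | inj₂ 1+a≡b = inj₂ (inj₁ (sym 1+a≡b))
UArcRel-connex {a} {b} a≢b | tri> _ _ b<a with m≤n⇒m<n∨m≡n b<a
...   | inj₁ 1+b<a = inj₂ (inj₂ 1+b<a)
...   | inj₂ 1+b≡a = inj₁ (inj₁ (sym 1+b≡a))

UArc⇒UArcRel : ∀ k (i j : Fin k) → UArc k i j ≡ true → UArcRel (toℕ i) (toℕ j)
UArc⇒UArcRel k i j eq with Equivalence.to T-∨ (Equivalence.from T-≡ eq)
... | inj₁ i≡1+j = inj₁ (≡ᵇ⇒≡ _ _ i≡1+j)
... | inj₂ 1+i<j = inj₂ (<ᵇ⇒< _ _ 1+i<j)

UArcRel⇒UArc : ∀ k (i j : Fin k) → UArcRel (toℕ i) (toℕ j) → UArc k i j ≡ true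
UArcRel⇒UArc k i j r = Equivalence.to T-≡ (Equivalence.from T-∨ (map (≡⇒≡ᵇ _ _) <⇒<ᵇ r))

module _ {n} (T : Tournament n) where

  arc-asymmetric : ∀ {u w} → arc T u w ≡ true → arc T w u ≢ true
  arc-asymmetric {u} {w} uw wu with u ≟ w
  ... | yes refl = contradiction (trans (sym uw) (loopless T u)) λ ()
  ... | no u≢w   = not-¬ (sym wu) (trans (sym uw) (oneArc T u w u≢w))

  arc-connex : ∀ {u w} → u ≢ w → arc T u w ≡ true ⊎ arc T w u ≡ true
  arc-connex {u} {w} u≢w with arc T w u in wu
  ... | true  = inj₂ refl
  ... | false = inj₁ (trans (oneArc T u w u≢w) (cong not wu))

  injective⇒≤indeg : ∀ {m x} (f : Fin m → Fin n) → Injective _≡_ _≡_ f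
                   → (∀ a → arc T (f a) x ≡ true) → m ≤ indeg T x
  injective⇒≤indeg {x = x} f f-inj f→x = injective⇒≤length _ f f-inj λ a →
    ∈-filter⁺ (T? ∘ λ u → arc T u x) (∈-allFin (f a)) (Equivalence.from T-≡ (f→x a))

module Chain {n k} (T : Tournament n) (v : Fin k → Fin n) (v-injective : Injective _≡_ _≡_ v)
  (backArc : ∀ i j → toℕ i ≡ suc (toℕ j) → arc T (v i) (v j) ≡ true)
  (indeg≤ : ∀ i → indeg T (v i) ≤ suc (toℕ i ∸ 1)) where

  v-≢ : ∀ {a b} → toℕ a ≢ toℕ b → v a ≢ v b
  v-≢ a≢b = a≢b ∘ cong toℕ ∘ v-injective

  indeg-lowerBound : ∀ i j → suc (toℕ i) < toℕ j → arc T (v j) (v i) ≡ true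
                   → (∀ m → suc (toℕ m) < toℕ i → arc T (v m) (v i) ≡ true)
                   → suc (suc (toℕ i ∸ 1)) ≤ indeg T (v i)
  indeg-lowerBound i j 1+i<j ji lowerArcs =
    injective⇒≤indeg T inNeighbour inNeighbour-injective inNeighbour→vᵢ
    where
    i+1 : Fin k
    i+1 = fromℕ< (<-trans 1+i<j (toℕ<n j))

    i<i+1 : toℕ i < toℕ i+1
    i<i+1 = subst (toℕ i <_) (sym (toℕ-fromℕ< _)) (n<1+n (toℕ i))

    i+1<j : toℕ i+1 < toℕ j
    i+1<j = subst (_< toℕ j) (sym (toℕ-fromℕ< _)) 1+i<j

    lower : Fin (toℕ i ∸ 1) → Fin k
    lower m = inject≤ m (≤-trans (m∸n≤m (toℕ i) 1) (<⇒≤ (toℕ<n i)))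

    1+lower<i : ∀ m → suc (toℕ (lower m)) < toℕ i
    1+lower<i m = subst (λ x → suc x < toℕ i) (sym (toℕ-inject≤ m _)) (m<n∸1⇒1+m<n (toℕ i) (toℕ<n m))

    lower<i+1 : ∀ m → toℕ (lower m) < toℕ i+1
    lower<i+1 m = <-trans (<-trans (n<1+n _) (1+lower<i m)) i<i+1

    inNeighbour : Fin (suc (suc (toℕ i ∸ 1))) → Fin n
    inNeighbour = v j ∷ v i+1 ∷ v ∘ lower

    inNeighbour-injective : Injective _≡_ _≡_ inNeighbour
    inNeighbour-injective =
      injective-∷ (injective-∷ (inject≤-injective _ _ _ _ ∘ v-injective) (v-≢ ∘ >⇒≢ ∘ lower<i+1))
        λ { Fin.zero → v-≢ (>⇒≢ i+1<j) ; (Fin.suc m) → v-≢ (>⇒≢ (<-trans (lower<i+1 m) i+1<j)) }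

    inNeighbour→vᵢ : ∀ a → arc T (inNeighbour a) (v i) ≡ true
    inNeighbour→vᵢ Fin.zero             = ji
    inNeighbour→vᵢ (Fin.suc Fin.zero)    = backArc i+1 i (toℕ-fromℕ< _)
    inNeighbour→vᵢ (Fin.suc (Fin.suc m)) = lowerArcs (lower m) (1+lower<i m)

  forwardArc : ∀ i j → suc (toℕ i) < toℕ j → arc T (v i) (v j) ≡ true
  forwardArc i = go i (<-wellFounded i)
    where
    go : ∀ i → Acc _<ᶠ_ i → ∀ j → suc (toℕ i) < toℕ j → arc T (v i) (v j) ≡ true
    go i (acc rec) j 1+i<j with arc-connex T (v-≢ (<⇒≢ (<-trans (n<1+n _) 1+i<j)))
    ... | inj₁ ij = ij
    ... | inj₂ ji = contradiction (≤-trans (indeg-lowerBound i j 1+i<j ji lowerArcs) (indeg≤ i)) (n≮n _)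
      where
      lowerArcs : ∀ m → suc (toℕ m) < toℕ i → arc T (v m) (v i) ≡ true
      lowerArcs m 1+m<i = go m (rec (<-trans (n<1+n _) 1+m<i)) i 1+m<i

  UArcRel⇒arc : ∀ i j → UArcRel (toℕ i) (toℕ j) → arc T (v i) (v j) ≡ true
  UArcRel⇒arc i j (inj₁ i≡1+j) = backArc i j i≡1+j
  UArcRel⇒arc i j (inj₂ 1+i<j) = forwardArc i j 1+i<j

  arc⇒UArcRel : ∀ i j → arc T (v i) (v j) ≡ true → UArcRel (toℕ i) (toℕ j)
  arc⇒UArcRel i j ij with i ≟ j
  ... | yes refl = contradiction ij (arc-asymmetric T ij)
  ... | no i≢j with UArcRel-connex (i≢j ∘ toℕ-injective)
  ...   | inj₁ r = r
  ...   | inj₂ r = contradiction (UArcRel⇒arc j i r) (arc-asymmetric T ij)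

  arc≡UArc : ∀ i j → arc T (v i) (v j) ≡ UArc k i j
  arc≡UArc i j = ⇔→≡ (mk⇔ (UArcRel⇒UArc k i j ∘ arc⇒UArcRel i j) (UArcRel⇒arc i j ∘ UArc⇒UArcRel k i j))

mainTheorem18 : ∀ {n : ℕ} (T : Tournament n) (k : ℕ) → 2 ≤ k
    → (v : Fin k → Fin n) → Injective _≡_ _≡_ v
    → (∀ (i : Fin k) → toℕ i ≡ 0 → indeg T (v i) ≡ 1)
    → (∀ (i j : Fin k) → toℕ i ≡ suc (toℕ j)
         → (arc T (v i) (v j) ≡ true) × (indeg T (v i) ≡ toℕ i))
    → ∀ (i j : Fin k) → arc T (v i) (v j) ≡ UArc k i j
mainTheorem18 T k _ v v-injective indeg₀ consecutive =
  Chain.arc≡UArc T v v-injective (λ i j → proj₁ ∘ consecutive i j) indeg≤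
  where
  indeg≤ : ∀ i → indeg T (v i) ≤ suc (toℕ i ∸ 1)
  indeg≤ i with toℕ i in i≡
  ... | zero  = ≤-reflexive (indeg₀ i i≡)
  ... | suc m = ≤-reflexive (trans (proj₂ (consecutive i j i≡1+j)) i≡)
    where
    m<k : m < k
    m<k = <-trans (n<1+n m) (subst (_< k) i≡ (toℕ<n i))

    j : Fin k
    j = fromℕ< m<k

    i≡1+j : toℕ i ≡ suc (toℕ j)
    i≡1+j = trans i≡ (cong suc (sym (toℕ-fromℕ< m<k)))
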